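{- Every composition $\alpha$ and every positive integer $m$ satisfy $F_{\alpha\odot(m)}=F_\alpha\triangleright h_m$.
   Context: Let $\mathbf{k}$ be a commutative ring and $\mathbf{k}[[x_1,x_2,\ldots]]$ the ring of formal power series in commuting indeterminates, with the product topology. For a monomial $\mathfrak m=x_1^{a_1}x_2^{a_2}\cdots$, $\mathrm{Supp}\,\mathfrak m=\{i:a_i>0\}$, with $\min\varnothing=\infty$, $\max\varnothing=0$. $\triangleright$ is the unique $\mathbf{k}$-bilinear continuous binary operation with $\mathfrak m\triangleright\mathfrak n=\mathfrak m\mathfrak n$ if $\max(\mathrm{Supp}\,\mathfrak m)\le\min(\mathrm{Supp}\,\mathfrak n)$ and $0$ otherwise. A composition is a finite sequence of positive integers; for a composition $\alpha=(\alpha_1,\ldots,\alpha_\ell)$ of $n$, $D(\alpha)=\{\alpha_1,\ldots,\alpha_1+\cdots+\alpha_{\ell-1}\}$ and $F_\alpha=\sum x_{i_1}\cdots x_{i_n}$ over $i_1\le\cdots\le i_n$ with $i_j<i_{j+1}$ for $j\in D(\alpha)$. $h_m=\sum_{1\le i_1\le\cdots\le i_m}x_{i_1}\cdots x_{i_m}$. For compositions $\alpha,\beta$: $\alpha\odot\beta=\beta$ if $\alpha$ is empty, $=\alpha$ if $\beta$ is empty, otherwise $(\alpha_1,\ldots,\alpha_{\ell-1},\alpha_\ell+\beta_1,\beta_2,\ldots,\beta_m)$. -}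

module Defs where

open import Algebra.Bundles using (CommutativeRing)
open import Data.Bool using (Bool; true; false; _∧_)
open import Data.List using (List; []; _∷_; length; take; drop; map; foldr; upTo)
open import Data.Bool.ListAction using (and)
open import Data.Nat.ListAction using (sum)
open import Data.Nat using (ℕ; zero; suc; _+_; _∸_; _≡ᵇ_; _<ᵇ_)

-- Compositions are lists of positive naturals (positivity imposed in the statement).

D : List ℕ → List ℕ
D []           = []
D (a ∷ [])     = []
D (a ∷ b ∷ r)  = a ∷ map (a +_) (D (b ∷ r))

infixr 5 _⊙_
_⊙_ : List ℕ → List ℕ → List ℕ
[] ⊙ β                  = β
(a ∷ []) ⊙ []           = a ∷ []
(a ∷ []) ⊙ (b ∷ β)      = (a + b) ∷ β
(a ∷ a′ ∷ α) ⊙ β        = a ∷ ((a′ ∷ α) ⊙ β)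

-- A monomial x_{i₁} x_{i₂} ⋯ x_{i_n} (i₁ ≤ ⋯ ≤ i_n) is represented by the
-- weakly increasing list [i₁, …, i_n] of positive indices (a bijection with
-- monomials).  A formal power series is its coefficient function.

-- entry at 0-based position p (default 0 out of range)
at : List ℕ → ℕ → ℕ
at []       _       = 0
at (x ∷ xs) zero    = x
at (x ∷ xs) (suc p) = at xs p

-- i_j < i_{j+1}  (1-based j), i.e. entries at 0-based positions j-1, j
strictAt : List ℕ → ℕ → Bool
strictAt w j = at w (j ∸ 1) <ᵇ at w j

module _ {c ℓ} (R : CommutativeRing c ℓ) where
  open CommutativeRing R using (Carrier; 0#; 1#) renaming (_+_ to _+R_; _*_ to _*R_)

  Series : Set c
  Series = List ℕ → Carrier

  indicator : Bool → Carrier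
  indicator true  = 1#
  indicator false = 0#

  F : List ℕ → Series
  F α w = indicator ((length w ≡ᵇ sum α) ∧ and (map (strictAt w) (D α)))

  h : ℕ → Series
  h m w = indicator (length w ≡ᵇ m)

  -- f ▷ g: coefficient of w is the sum over all factorizations w = 𝔪 𝔫 with
  -- max Supp 𝔪 ≤ min Supp 𝔫, i.e. over splittings of the sorted list w into
  -- a prefix and a suffix.
  _▷_ : Series → Series → Series
  (f ▷ g) w = foldr _+R_ 0# (map (λ k → f (take k w) *R g (drop k w)) (upTo (suc (length w))))

-- The coefficient of w in F_α ▷ h_m is a sum over the splittings w = u v of
-- F_α(u) h_m(v), which vanishes unless |u| = |α| and |v| = m.  So it is zero
-- unless |w| = |α| + m, and then only the split at position |α| survives,
-- with h_m(v) = 1.  Since D(α ⊙ (m)) = D(α) and every descent of α lies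
-- strictly below |α|, the descent conditions F_{α⊙(m)} imposes on w are
-- exactly those F_α imposes on the prefix u.
module Submission where

open import Defs
open import Algebra.Bundles using (Monoid; CommutativeRing)
open import Data.Bool using (true; false; _∧_)
open import Data.Bool.ListAction using (and)
open import Data.List using (List; []; _∷_; length; take; drop; map; foldr; applyUpTo)
open import Data.List.Properties using (map-upTo; length-take; length-drop)
open import Data.List.Relation.Unary.All using (All; []; _∷_)
open import Data.List.Relation.Unary.All.Properties using (map⁺)
import Data.List.Relation.Unary.All as All
open import Data.List.Relation.Unary.Linked using (Linked)
open import Data.Nat using (ℕ; zero; suc; _+_; _∸_; _≡ᵇ_; _<ᵇ_; _≤_; _<_; _⊓_; s≤s)
open import Data.Nat.ListAction using (sum)
open import Data.Nat.Properties
  using (+-identityʳ; +-assoc; suc-injective; m<m+n; m≤m+n; <-≤-trans; ≤-<-trans; +-monoʳ-<;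
         m∸n≤m; m≤n⇒m⊓n≡m; m+n∸m≡n; _≟_)
open import Data.Product using (_×_; _,_; proj₁; proj₂)
open import Function using (_∘_)
open import Relation.Nullary using (¬_; yes; no; contradiction)
open import Relation.Nullary.Decidable using (dec-true; dec-false)
open import Relation.Binary.PropositionalEquality
  using (_≡_; _≢_; refl; sym; trans; cong; cong₂; subst; module ≡-Reasoning)

D-⊙-singleton : ∀ α m → D (α ⊙ (m ∷ [])) ≡ D α
D-⊙-singleton []                m = refl
D-⊙-singleton (a ∷ [])          m = refl
D-⊙-singleton (a ∷ b ∷ [])      m = refl
D-⊙-singleton (a ∷ b ∷ c ∷ α)   m =
  cong (λ d → a ∷ map (a +_) d) (D-⊙-singleton (b ∷ c ∷ α) m)

sum-⊙-singleton : ∀ α m → sum (α ⊙ (m ∷ [])) ≡ sum α + m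
sum-⊙-singleton []            m = +-identityʳ m
sum-⊙-singleton (a ∷ [])      m = trans (+-identityʳ (a + m)) (cong (_+ m) (sym (+-identityʳ a)))
sum-⊙-singleton (a ∷ b ∷ α)   m =
  trans (cong (a +_) (sum-⊙-singleton (b ∷ α) m)) (sym (+-assoc a (sum (b ∷ α)) m))

D-<-sum : ∀ α → All (0 <_) α → All (_< sum α) (D α)
D-<-sum []          _ = []
D-<-sum (a ∷ [])    _ = []
D-<-sum (a ∷ b ∷ α) (_ ∷ 0<b ∷ 0<α) =
  m<m+n a (<-≤-trans 0<b (m≤m+n b (sum α))) ∷
  map⁺ (All.map (+-monoʳ-< a) (D-<-sum (b ∷ α) (0<b ∷ 0<α)))

at-take : ∀ n w {i} → i < n → at (take n w) i ≡ at w i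
at-take (suc n) []      _             = refl
at-take (suc n) (x ∷ w) {zero}  _     = refl
at-take (suc n) (x ∷ w) {suc i} (s≤s i<n) = at-take n w i<n

strictAt-take : ∀ n w {j} → j < n → strictAt (take n w) j ≡ strictAt w j
strictAt-take n w {j} j<n =
  cong₂ _<ᵇ_ (at-take n w (≤-<-trans (m∸n≤m j 1) j<n)) (at-take n w j<n)

map-cong-All : ∀ {A B : Set} {P : A → Set} {f g : A → B} {xs} →
  All P xs → (∀ {x} → P x → f x ≡ g x) → map f xs ≡ map g xs
map-cong-All []         _   = refl
map-cong-All (px ∷ pxs) f≡g = cong₂ _∷_ (f≡g px) (map-cong-All pxs f≡g)

≡ᵇ-true : ∀ {m n} → m ≡ n → (m ≡ᵇ n) ≡ true
≡ᵇ-true {m} {n} = dec-true (m ≟ n)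

≡ᵇ-false : ∀ {m n} → m ≢ n → (m ≡ᵇ n) ≡ false
≡ᵇ-false {m} {n} = dec-false (m ≟ n)

length-take-+ : ∀ n (w : List ℕ) {m} → length w ≡ n + m → length (take n w) ≡ n
length-take-+ n w {m} |w|≡ = begin
  length (take n w)  ≡⟨ length-take n w ⟩
  n ⊓ length w       ≡⟨ m≤n⇒m⊓n≡m (subst (n ≤_) (sym |w|≡) (m≤m+n n m)) ⟩
  n                  ∎
  where open ≡-Reasoning

length-drop-+ : ∀ n (w : List ℕ) {m} → length w ≡ n + m → length (drop n w) ≡ m
length-drop-+ n w {m} |w|≡ = begin
  length (drop n w)  ≡⟨ length-drop n w ⟩
  length w ∸ n       ≡⟨ cong (_∸ n) |w|≡ ⟩
  n + m ∸ n          ≡⟨ m+n∸m≡n n m ⟩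
  m                  ∎
  where open ≡-Reasoning

take-drop-lengths : ∀ k (w : List ℕ) {n m} → 0 < m →
  length (take k w) ≡ n → length (drop k w) ≡ m → k ≡ n × length w ≡ n + m
take-drop-lengths zero    w       _   refl |drop| = refl , |drop|
take-drop-lengths (suc k) []      ()  _    refl
take-drop-lengths (suc k) (x ∷ w) {suc n} 0<m |take| |drop|
  with k≡n , |w|≡ ← take-drop-lengths k w 0<m (suc-injective |take|) |drop| =
  cong suc k≡n , cong suc |w|≡

module MonoidSums {a ℓ} (M : Monoid a ℓ) where
  open Monoid M renaming (refl to ≈-refl; trans to ≈-trans)

  ∑< : ℕ → (ℕ → Carrier) → Carrier
  ∑< N G = foldr _∙_ ε (applyUpTo G N)

  ∑<-≈ε : ∀ N (G : ℕ → Carrier) → (∀ k → G k ≈ ε) → ∑< N G ≈ ε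
  ∑<-≈ε zero    G G≈ε = ≈-refl
  ∑<-≈ε (suc N) G G≈ε =
    ≈-trans (∙-cong (G≈ε 0) (∑<-≈ε N (G ∘ suc) (G≈ε ∘ suc))) (identityˡ ε)

  ∑<-single : ∀ N (G : ℕ → Carrier) {p} → p < N → (∀ k → k ≢ p → G k ≈ ε) →
    ∑< N G ≈ G p
  ∑<-single (suc N) G {zero}  _ G≈ε =
    ≈-trans (∙-congˡ (∑<-≈ε N (G ∘ suc) (λ k → G≈ε (suc k) (λ ())))) (identityʳ (G 0))
  ∑<-single (suc N) G {suc p} (s≤s p<N) G≈ε =
    ≈-trans (∙-congʳ (G≈ε 0 (λ ()))) (≈-trans (identityˡ _)
      (∑<-single N (G ∘ suc) p<N (λ k k≢p → G≈ε (suc k) (k≢p ∘ suc-injective))))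

module Coefficients {c ℓ} (R : CommutativeRing c ℓ) where
  open CommutativeRing R
    using (Carrier; _≈_; 0#; 1#; +-monoid; zeroˡ; zeroʳ; *-identityʳ; setoid)
    renaming (_+_ to _⊕_; _*_ to _⊛_)
  open MonoidSums +-monoid
  open import Relation.Binary.Reasoning.Setoid setoid

  splitting-term : Series R → Series R → List ℕ → ℕ → Carrier
  splitting-term f g w k = f (take k w) ⊛ g (drop k w)

  ▷-as-∑ : ∀ f g w → (_▷_ R f g) w ≡ ∑< (suc (length w)) (splitting-term f g w)
  ▷-as-∑ f g w = cong (foldr _⊕_ 0#) (map-upTo _ (suc (length w)))

  F-⊙-singleton : ∀ α m w →
    F R (α ⊙ (m ∷ [])) w ≡ indicator R ((length w ≡ᵇ sum α + m) ∧ and (map (strictAt w) (D α)))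
  F-⊙-singleton α m w rewrite sum-⊙-singleton α m | D-⊙-singleton α m = refl

  F-⊙-singleton-≡0 : ∀ α m w → length w ≢ sum α + m → F R (α ⊙ (m ∷ [])) w ≡ 0#
  F-⊙-singleton-≡0 α m w |w|≢ =
    trans (F-⊙-singleton α m w)
          (cong (λ b → indicator R (b ∧ and (map (strictAt w) (D α)))) (≡ᵇ-false |w|≢))

  F-⊙-singleton-take : ∀ α → All (0 <_) α → ∀ m w → length w ≡ sum α + m →
    F R (α ⊙ (m ∷ [])) w ≡ F R α (take (sum α) w)
  F-⊙-singleton-take α 0<α m w |w|≡ =
    trans (F-⊙-singleton α m w) (cong (indicator R) (cong₂ _∧_ length≡ᵇ descents≡))
    where
    length≡ᵇ : (length w ≡ᵇ sum α + m) ≡ (length (take (sum α) w) ≡ᵇ sum α)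
    length≡ᵇ = trans (≡ᵇ-true |w|≡) (sym (≡ᵇ-true (length-take-+ (sum α) w |w|≡)))
    descents≡ : and (map (strictAt w) (D α)) ≡ and (map (strictAt (take (sum α) w)) (D α))
    descents≡ = cong and (map-cong-All (D-<-sum α 0<α) (sym ∘ strictAt-take (sum α) w))

  splitting-term-≈0 : ∀ α m → 0 < m → ∀ w k → ¬ (k ≡ sum α × length w ≡ sum α + m) →
    splitting-term (F R α) (h R m) w k ≈ 0#
  splitting-term-≈0 α m 0<m w k ¬split with length (take k w) ≟ sum α | length (drop k w) ≟ m
  ... | no |u|≢ | _         rewrite ≡ᵇ-false |u|≢ = zeroˡ _
  ... | yes _   | no |v|≢   rewrite ≡ᵇ-false |v|≢ = zeroʳ _
  ... | yes |u|≡ | yes |v|≡ = contradiction (take-drop-lengths k w 0<m |u|≡ |v|≡) ¬split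

  F▷h-≈0 : ∀ α m → 0 < m → ∀ w → length w ≢ sum α + m → (_▷_ R (F R α) (h R m)) w ≈ 0#
  F▷h-≈0 α m 0<m w |w|≢ = begin
    (_▷_ R (F R α) (h R m)) w                ≡⟨ ▷-as-∑ (F R α) (h R m) w ⟩
    ∑< (suc (length w)) (splitting-term (F R α) (h R m) w)
      ≈⟨ ∑<-≈ε (suc (length w)) _ (λ k → splitting-term-≈0 α m 0<m w k (|w|≢ ∘ proj₂)) ⟩
    0#                                       ∎

  F▷h-≈-take : ∀ α m → 0 < m → ∀ w → length w ≡ sum α + m →
    (_▷_ R (F R α) (h R m)) w ≈ F R α (take (sum α) w)
  F▷h-≈-take α m 0<m w |w|≡ = begin
    (_▷_ R (F R α) (h R m)) w                ≡⟨ ▷-as-∑ (F R α) (h R m) w ⟩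
    ∑< (suc (length w)) (splitting-term (F R α) (h R m) w)
      ≈⟨ ∑<-single (suc (length w)) _ (s≤s |α|≤|w|)
           (λ k k≢|α| → splitting-term-≈0 α m 0<m w k (k≢|α| ∘ proj₁)) ⟩
    F R α (take (sum α) w) ⊛ h R m (drop (sum α) w) ≡⟨ cong (F R α (take (sum α) w) ⊛_) h≡1 ⟩
    F R α (take (sum α) w) ⊛ 1#              ≈⟨ *-identityʳ _ ⟩
    F R α (take (sum α) w)                   ∎
    where
    |α|≤|w| : sum α ≤ length w
    |α|≤|w| = subst (sum α ≤_) (sym |w|≡) (m≤m+n (sum α) m)
    h≡1 : h R m (drop (sum α) w) ≡ 1#
    h≡1 = cong (indicator R) (≡ᵇ-true (length-drop-+ (sum α) w |w|≡))

  F-⊙-singleton≈F▷h : ∀ α → All (0 <_) α → ∀ m → 0 < m → ∀ w →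
    F R (α ⊙ (m ∷ [])) w ≈ (_▷_ R (F R α) (h R m)) w
  F-⊙-singleton≈F▷h α 0<α m 0<m w with length w ≟ sum α + m
  ... | no |w|≢ = begin
    F R (α ⊙ (m ∷ [])) w       ≡⟨ F-⊙-singleton-≡0 α m w |w|≢ ⟩
    0#                         ≈⟨ F▷h-≈0 α m 0<m w |w|≢ ⟨
    (_▷_ R (F R α) (h R m)) w  ∎
  ... | yes |w|≡ = begin
    F R (α ⊙ (m ∷ [])) w       ≡⟨ F-⊙-singleton-take α 0<α m w |w|≡ ⟩
    F R α (take (sum α) w)     ≈⟨ F▷h-≈-take α m 0<m w |w|≡ ⟨
    (_▷_ R (F R α) (h R m)) w  ∎

-- The identity holds coefficientwise at every list w; the hypotheses that w
-- encodes a monomial (sorted, positive indices) are not needed.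
corollary3p9 : ∀ {c ℓ} (R : CommutativeRing c ℓ) (α : List ℕ) → All (0 <_) α →
    (m : ℕ) → 0 < m →
    (w : List ℕ) → Linked _≤_ w → All (1 ≤_) w →
    CommutativeRing._≈_ R (F R (α ⊙ (m ∷ [])) w) (_▷_ R (F R α) (h R m) w)
corollary3p9 R α 0<α m 0<m w _ _ = Coefficients.F-⊙-singleton≈F▷h R α 0<α m 0<m w
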